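{- (Decidability of guardedness checking.) For a given signature $\Sigma$, it is decidable whether $Q;C\vdash_\Sigma r\rtimes M$ holds, for arbitrary well-formed recursion constant $r$, term $M$, finite set $Q$ of recursion constants and finite set $C$ of constructors.
   Context: CoLF terms: $M::=H\cdot S\mid\lambda x.M$, $H::=x\mid c\mid r$ (variables, constructors, recursion constants with definitions $r:A=M$ in the finite signature $\Sigma$), spines $S::=()\mid M;S\mid[x];S$; $S\ \mathsf{prepat}$ means $S$ consists only of prepattern arguments $[x]$. Constructors inherit a priority from their target type family (families declared later have higher priority) and are coinductive if that family's kind ends in $\mathsf{cotype}$. $C\ \mathsf{validtrace}$ holds iff $C$ contains a coinductive constructor whose priority is highest among the constructors in $C$. The judgment $Q;C\vdash_\Sigma r\rtimes M$ is defined by the rules: $\lambda x.M$ if $M$; $c\cdot S$ if $Q;C\cup\{c\}\vdash r\rtimes S$; $x\cdot S$ if $Q;C\vdash r\rtimes S$; $r'\cdot S$ if $r'\neq r$ and $r'\in Q$; $r\cdot S$ if $C\ \mathsf{validtrace}$; $r'\cdot S$ with $r'\neq r$, $r'\notin Q$, if $r':A=M'\in\Sigma$, $S\ \mathsf{prepat}$ and $Q\cup\{r'\};C\vdash r\rtimes M'$. On spines: $()$ always; $M;S$ if both $M$ and $S$; $[x];S$ if $S$. -}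

module Defs where

open import Data.Nat using (ℕ; _≤_)
open import Data.Fin using (Fin; toℕ)
open import Data.Fin.Subset using (Subset; _∈_; _∉_; _∪_; ⁅_⁆)
open import Data.Bool using (Bool; true)
open import Data.Product using (Σ; _×_)
open import Relation.Binary.PropositionalEquality using (_≡_; _≢_)

-- CoLF raw syntax over nc constructors and nr recursion constants.
-- Variables are names (ℕ).
mutual
  data Head (nc nr : ℕ) : Set where
    var : ℕ → Head nc nr
    con : Fin nc → Head nc nr
    rec : Fin nr → Head nc nr

  data Term (nc nr : ℕ) : Set where
    app : Head nc nr → Spine nc nr → Term nc nr
    lam : ℕ → Term nc nr → Term nc nr

  data Spine (nc nr : ℕ) : Set where
    nil   : Spine nc nr
    cons  : Term nc nr → Spine nc nr → Spine nc nr
    pcons : ℕ → Spine nc nr → Spine nc nr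

data Prepat {nc nr : ℕ} : Spine nc nr → Set where
  nil   : Prepat nil
  pcons : ∀ x {S} → Prepat S → Prepat (pcons x S)

-- Finite signature: nf type families (declaration order = index order),
-- each marked as ending in cotype or not; nc constructors with target family;
-- nr recursion constants r with definitions r = M.
record Signature : Set where
  field
    nf nc nr : ℕ
    cotype   : Fin nf → Bool
    target   : Fin nc → Fin nf
    def      : Fin nr → Term nc nr

  priority : Fin nc → ℕ
  priority c = toℕ (target c)

  Coinductive : Fin nc → Set
  Coinductive c = cotype (target c) ≡ true

  ValidTrace : Subset nc → Set
  ValidTrace C = Σ (Fin nc) λ c → c ∈ C × Coinductive c ×
                   (∀ c' → c' ∈ C → priority c' ≤ priority c)

  mutual
    data Guarded (Q : Subset nr) (C : Subset nc) (r : Fin nr) : Term nc nr → Set where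
      g-lam    : ∀ {x M} → Guarded Q C r M → Guarded Q C r (lam x M)
      g-con    : ∀ {c S} → GuardedS Q (C ∪ ⁅ c ⁆) r S → Guarded Q C r (app (con c) S)
      g-var    : ∀ {x S} → GuardedS Q C r S → Guarded Q C r (app (var x) S)
      g-recQ   : ∀ {r' S} → r' ≢ r → r' ∈ Q → Guarded Q C r (app (rec r') S)
      g-self   : ∀ {S} → ValidTrace C → Guarded Q C r (app (rec r) S)
      g-unfold : ∀ {r' S} → r' ≢ r → r' ∉ Q → Prepat S →
                 Guarded (Q ∪ ⁅ r' ⁆) C r (def r') → Guarded Q C r (app (rec r') S)

    data GuardedS (Q : Subset nr) (C : Subset nc) (r : Fin nr) : Spine nc nr → Set where
      gs-nil   : GuardedS Q C r nil
      gs-cons  : ∀ {M S} → Guarded Q C r M → GuardedS Q C r S → GuardedS Q C r (cons M S)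
      gs-pcons : ∀ {x S} → GuardedS Q C r S → GuardedS Q C r (pcons x S)

module Submission where

-- Every rule of ⊢ ⋊ except unfolding recurses on a subterm; unfolding r' replaces the term by
-- the definition of r' but adds r' ∉ Q to Q. Since Q ⊆ Fin nr, at most nr unfoldings can occur
-- along any derivation, so the rules can be read as a terminating decision procedure by
-- recursion on the number k of unfoldings still available (nr ≤ k + ∣Q∣) and then on the term.

open import Defs
open import Data.Fin using (Fin)
open import Data.Fin.Subset using (Subset)
open import Relation.Nullary using (Dec)

open import Data.Empty using (⊥; ⊥-elim)
open import Data.Nat using (zero; suc; _+_; _≤_; _<_; _≤?_)
open import Data.Nat.Properties using (≤-trans; m≤m+n; +-monoʳ-≤; +-suc; <⇒≱)
open import Data.Fin.Properties using (any?; all?) renaming (_≟_ to _≟ᶠ_)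
open import Data.Fin.Subset using (_∈_; _∉_; _∪_; ⁅_⁆; ∣_∣)
open import Data.Fin.Subset.Properties using (_∈?_; p⊆p∪q; x∈p∪q⁺; x∈⁅x⁆; p⊂q⇒∣p∣<∣q∣; ∣p∣≤n)
open import Data.Bool.Properties using () renaming (_≟_ to _≟ᵇ_)
open import Data.Product using (_,_; uncurry)
open import Data.Sum using (inj₂)
open import Relation.Nullary using (yes; no; contradiction)
open import Relation.Nullary.Decidable using (map′; _×-dec_; _→-dec_)
open import Relation.Binary.PropositionalEquality using (refl; subst)

x∉p⇒∣p∣<∣p∪⁅x⁆∣ : ∀ {n} {p : Subset n} {x : Fin n} → x ∉ p → ∣ p ∣ < ∣ p ∪ ⁅ x ⁆ ∣
x∉p⇒∣p∣<∣p∪⁅x⁆∣ {p = p} {x} x∉p =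
  p⊂q⇒∣p∣<∣q∣ (p⊆p∪q ⁅ x ⁆ , x , x∈p∪q⁺ (inj₂ (x∈⁅x⁆ x)) , x∉p)

n≤∣p∣⇒¬x∉p : ∀ {n} {p : Subset n} {x : Fin n} → n ≤ ∣ p ∣ → x ∉ p → ⊥
n≤∣p∣⇒¬x∉p {p = p} {x} n≤∣p∣ x∉p =
  <⇒≱ (x∉p⇒∣p∣<∣p∪⁅x⁆∣ x∉p) (≤-trans (∣p∣≤n (p ∪ ⁅ x ⁆)) n≤∣p∣)

insert-outsider-spends-fuel : ∀ {n} k {p : Subset n} {x : Fin n} →
  n ≤ suc k + ∣ p ∣ → x ∉ p → n ≤ k + ∣ p ∪ ⁅ x ⁆ ∣
insert-outsider-spends-fuel k {p} {x} bound x∉p =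
  ≤-trans bound (subst (_≤ k + ∣ p ∪ ⁅ x ⁆ ∣) (+-suc k ∣ p ∣) (+-monoʳ-≤ k (x∉p⇒∣p∣<∣p∪⁅x⁆∣ x∉p)))

prepat? : ∀ {nc nr} (S : Spine nc nr) → Dec (Prepat S)
prepat? nil         = yes nil
prepat? (cons _ _)  = no λ ()
prepat? (pcons x S) = map′ (pcons x) (λ { (pcons _ p) → p }) (prepat? S)

module Guardedness (Σ : Signature) where
  open Signature Σ

  validTrace? : (C : Subset nc) → Dec (ValidTrace C)
  validTrace? C = any? λ c →
    (c ∈? C) ×-dec (cotype (target c) ≟ᵇ _) ×-dec
    all? (λ c' → (c' ∈? C) →-dec (priority c' ≤? priority c))

  mutual
    guarded? : ∀ k {Q} → nr ≤ k + ∣ Q ∣ → ∀ C r M → Dec (Guarded Q C r M)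
    guarded? k b C r (lam x M) =
      map′ g-lam (λ { (g-lam p) → p }) (guarded? k b C r M)
    guarded? k b C r (app (var x) S) =
      map′ g-var (λ { (g-var p) → p }) (guardedS? k b C r S)
    guarded? k b C r (app (con c) S) =
      map′ g-con (λ { (g-con p) → p }) (guardedS? k b (C ∪ ⁅ c ⁆) r S)
    guarded? k {Q} b C r (app (rec r') S) with r' ≟ᶠ r
    ... | yes refl = map′ g-self
          (λ { (g-self v) → v
             ; (g-recQ r≢r _) → contradiction refl r≢r
             ; (g-unfold r≢r _ _ _) → contradiction refl r≢r })
          (validTrace? C)
    ... | no r'≢r with r' ∈? Q
    ...   | yes r'∈Q = yes (g-recQ r'≢r r'∈Q)
    ...   | no r'∉Q = map′ (uncurry (g-unfold r'≢r r'∉Q))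
            (λ { (g-self _) → contradiction refl r'≢r ; (g-recQ _ r'∈Q) → contradiction r'∈Q r'∉Q
               ; (g-unfold _ _ pp g) → pp , g })
            (prepat? S ×-dec unfolding? k b C r r'∉Q)

    unfolding? : ∀ k {Q} → nr ≤ k + ∣ Q ∣ → ∀ C r {r'} → r' ∉ Q →
                 Dec (Guarded (Q ∪ ⁅ r' ⁆) C r (def r'))
    unfolding? zero    b C r r'∉Q = ⊥-elim (n≤∣p∣⇒¬x∉p b r'∉Q)
    unfolding? (suc k) b C r {r'} r'∉Q =
      guarded? k (insert-outsider-spends-fuel k b r'∉Q) C r (def r')

    guardedS? : ∀ k {Q} → nr ≤ k + ∣ Q ∣ → ∀ C r S → Dec (GuardedS Q C r S)
    guardedS? k b C r nil = yes gs-nil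
    guardedS? k b C r (cons M S) =
      map′ (uncurry gs-cons) (λ { (gs-cons p q) → p , q })
        (guarded? k b C r M ×-dec guardedS? k b C r S)
    guardedS? k b C r (pcons x S) =
      map′ gs-pcons (λ { (gs-pcons p) → p }) (guardedS? k b C r S)

theorem9 : (Σ : Signature) → let open Signature Σ in
    (Q : Subset nr) (C : Subset nc) (r : Fin nr) (M : Term nc nr) →
    Dec (Guarded Q C r M)
theorem9 Σ Q C r M = Guardedness.guarded? Σ nr (m≤m+n nr ∣ Q ∣) C r M
  where open Signature Σ
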